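{- Let $G$ be a general two-prover game on a bi-regular bipartite graph $((X,Y),E)$ with alphabets $\Sigma_X$ and $\Sigma_Y$. Let $k$ be a positive integer and $\epsilon,\delta>0$ be such that $2\delta|\Sigma_X\times\Sigma_Y|^{k-1}\le\epsilon$, and suppose $G$ is $(\delta,\epsilon)$-robust. Then $\mathrm{val}(G^k)\le(\mathrm{val}(G)+\epsilon)^k+k\epsilon$.
   Context: A (general) two-prover game is given by a bipartite (multi)graph $((X,Y),E)$, alphabets $\Sigma_X,\Sigma_Y$, and constraints $\psi_e\subseteq\Sigma_X\times\Sigma_Y$ for $e\in E$. The verifier picks a uniformly random edge $(x,y)$, sends $x$ to prover 1 and $y$ to prover 2, and accepts if their answers satisfy $\psi_{(x,y)}$; $\mathrm{val}(G)$ is the maximum acceptance probability over prover strategies. For $S\subseteq X,T\subseteq Y$, $G_{S\times T}$ is the game where the edge is uniform conditioned on $x\in S,y\in T$. $G$ is $(\delta,\epsilon)$-robust if $\mathrm{val}(G_{S\times T})\le\mathrm{val}(G)+\epsilon$ whenever $|S|\ge\delta|X|$, $|T|\ge\delta|Y|$. The $k$-fold repetition $G^k$: the verifier picks $k$ independent uniform edges $(x_1,y_1),\dots,(x_k,y_k)$, sends $(x_1,\dots,x_k)$ to prover 1 and $(y_1,\dots,y_k)$ to prover 2, each prover answers a $k$-tuple of labels, and the verifier accepts iff all $k$ constraints are satisfied. -}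

module Defs where

open import Data.Nat as ℕ using (ℕ; zero; suc)
open import Data.Integer using (+_)
open import Data.Rational using (ℚ; _/_; _*_; _+_; _≤_; 1ℚ)
open import Data.Bool using (Bool; true; false; _∧_; if_then_else_)
open import Data.List using (List; []; _∷_; length; filter; map; concatMap)
open import Data.Vec as Vec using (Vec; []; _∷_)
open import Data.Fin using (Fin)
open import Data.Fin.Subset using (Subset; _∈_; ∣_∣)
open import Data.Fin.Subset.Properties using (_∈?_)
open import Data.Product using (_×_; _,_; Σ; ∃; ∃-syntax)
open import Relation.Binary.PropositionalEquality using (_≡_)
open import Relation.Nullary.Decidable using (⌊_⌋; _×-dec_)
open import Data.Bool.Properties using (T?)

ℕ→ℚ : ℕ → ℚ
ℕ→ℚ n = (+ n) / 1

_^ℚ_ : ℚ → ℕ → ℚ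
q ^ℚ zero  = 1ℚ
q ^ℚ suc n = q * (q ^ℚ n)

-- The bipartite multigraph is given by a list of edges; every edge carries
-- its own constraint ψ_e ⊆ ΣX × ΣY (as a Boolean predicate).
record Game (X Y ΣX ΣY : Set) : Set where
  constructor mkGame
  field
    edges : List (X × Y × (ΣX → ΣY → Bool))
open Game public

edgeX : ∀ {X Y ΣX ΣY : Set} → X × Y × (ΣX → ΣY → Bool) → X
edgeX (x , _ , _) = x

edgeY : ∀ {X Y ΣX ΣY : Set} → X × Y × (ΣX → ΣY → Bool) → Y
edgeY (_ , y , _) = y

numEdges : ∀ {X Y ΣX ΣY} → Game X Y ΣX ΣY → ℕ
numEdges G = length (edges G)

accCount : ∀ {X Y ΣX ΣY} → Game X Y ΣX ΣY → (X → ΣX) → (Y → ΣY) → ℕ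
accCount G f g = length (filter (λ e → T? (sat e)) (edges G))
  where
  sat : _ → Bool
  sat (x , y , ψ) = ψ (f x) (g y)

-- acceptance probability of (f , g): accCount / numEdges  (edges nonempty)
-- (written without division:  prob ≤ q  iff  accCount ≤ q · |E|)
AccLe : ∀ {X Y ΣX ΣY} → Game X Y ΣX ΣY → (X → ΣX) → (Y → ΣY) → ℚ → Set
AccLe G f g q = ℕ→ℚ (accCount G f g) ≤ q * ℕ→ℚ (numEdges G)

AccEq : ∀ {X Y ΣX ΣY} → Game X Y ΣX ΣY → (X → ΣX) → (Y → ΣY) → ℚ → Set
AccEq G f g q = ℕ→ℚ (accCount G f g) ≡ q * ℕ→ℚ (numEdges G)

ValLe : ∀ {X Y ΣX ΣY} → Game X Y ΣX ΣY → ℚ → Set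
ValLe G q = ∀ f g → AccLe G f g q

IsVal : ∀ {X Y ΣX ΣY} → Game X Y ΣX ΣY → ℚ → Set
IsVal G v = ValLe G v × ∃[ f ] ∃[ g ] AccEq G f g v

degX : ∀ {nX nY ΣX ΣY} → Game (Fin nX) (Fin nY) ΣX ΣY → Fin nX → ℕ
degX G x = length (filter (λ e → edgeX e Data.Fin.≟ x) (edges G))

degY : ∀ {nX nY ΣX ΣY} → Game (Fin nX) (Fin nY) ΣX ΣY → Fin nY → ℕ
degY G y = length (filter (λ e → edgeY e Data.Fin.≟ y) (edges G))

BiRegular : ∀ {nX nY ΣX ΣY} → Game (Fin nX) (Fin nY) ΣX ΣY → Set
BiRegular {nX} {nY} G =
  (∃[ dX ] (∀ x → degX G x ≡ dX)) × (∃[ dY ] (∀ y → degY G y ≡ dY))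

-- G_{S×T}: the edge is uniform conditioned on x ∈ S, y ∈ T
restrict : ∀ {nX nY ΣX ΣY} → Game (Fin nX) (Fin nY) ΣX ΣY →
           Subset nX → Subset nY → Game (Fin nX) (Fin nY) ΣX ΣY
restrict G S T = mkGame (filter (λ e → (edgeX e ∈? S) ×-dec (edgeY e ∈? T)) (edges G))

-- (δ,ε)-robustness: val(G_{S×T}) ≤ val(G) + ε whenever |S| ≥ δ|X|, |T| ≥ δ|Y|
-- (for those S, T for which G_{S×T} is defined, i.e. has at least one edge)
Robust : ∀ {nX nY ΣX ΣY} → Game (Fin nX) (Fin nY) ΣX ΣY → ℚ → ℚ → Set
Robust {nX} {nY} G δ ε = ∀ (v : ℚ) → IsVal G v →
  ∀ (S : Subset nX) (T : Subset nY) →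
  δ * ℕ→ℚ nX ≤ ℕ→ℚ ∣ S ∣ → δ * ℕ→ℚ nY ≤ ℕ→ℚ ∣ T ∣ →
  0 ℕ.< numEdges (restrict G S T) →
  ValLe (restrict G S T) (v + ε)

tuples : ∀ {A : Set} → (k : ℕ) → List A → List (Vec A k)
tuples zero    xs = [] ∷ []
tuples (suc k) xs = concatMap (λ a → map (a ∷_) (tuples k xs)) xs

allOK : ∀ {X Y ΣX ΣY : Set} {k} → Vec (X × Y × (ΣX → ΣY → Bool)) k →
        Vec ΣX k → Vec ΣY k → Bool
allOK []               []       []       = true
allOK ((_ , _ , ψ) ∷ es) (a ∷ as) (b ∷ bs) = ψ a b ∧ allOK es as bs

-- k-fold repetition G^k: k independent uniform edges
repeatGame : ∀ {X Y ΣX ΣY} → (k : ℕ) → Game X Y ΣX ΣY →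
             Game (Vec X k) (Vec Y k) (Vec ΣX k) (Vec ΣY k)
repeatGame k G = mkGame (map (λ es → Vec.map edgeX es , Vec.map edgeY es , allOK es)
                             (tuples k (edges G)))

module Submission where

-- Write c = val(G) + ε and let m be the number of edges.  We count, for strategies (F , H)
-- of the j-fold repetition, the number wins j F H of accepted j-tuples of edges, and show
-- wins j F H ≤ (c^j + j·ε)·m^j by induction on j (when c ≤ 1; otherwise the claim is trivial).
-- For the step we fix the last j edges of a (j+1)-tuple.  The first coordinate is then a
-- play of G in which each question x carries a label, the remaining j answers F gives to it;
-- the labels split X and Y into fibres, and the edges into cells.  On a cell whose two
-- fibres are both δ-large, robustness bounds the accepted edges by a c-fraction; cells with a
-- δ-small side hold at most (|ΣX|^j + |ΣY|^j)·δ·m ≤ ε·m edges, by bi-regularity.  Summing over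
-- the cells whose labels are themselves accepted gives  wins (j+1) ≤ c·∑_e wins j + ε·m^(j+1).

open import Defs
open import Data.Nat using (ℕ)
open import Data.Fin using (Fin)
open import Data.Rational as ℚ using (ℚ; 0ℚ)
open import Relation.Binary.PropositionalEquality using (_≡_)

module FiniteSums where
  open import Data.Nat using (ℕ; suc; _+_; _*_; _≤_; z≤n; s≤s)
  open import Data.Nat.Properties
  open import Data.Nat.Tactic.RingSolver using (solve-∀)
  open import Data.Bool using (Bool; true; false; _∧_)
  open import Data.Bool.Properties using (T?)
  open import Data.List using (List; []; _∷_; length; filter; map; concatMap; _++_)
  open import Relation.Nullary using (does; Dec)
  open import Relation.Unary using (Decidable)
  open import Relation.Binary.PropositionalEquality
  open ≡-Reasoning

  ∑ : ∀ {A : Set} → List A → (A → ℕ) → ℕ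
  ∑ []       f = 0
  ∑ (a ∷ as) f = f a + ∑ as f

  syntax ∑ l (λ a → t) = ∑[ a ∈ l ] t

  𝟙 : Bool → ℕ
  𝟙 true  = 1
  𝟙 false = 0

  𝟙? : ∀ {P : Set} → Dec P → ℕ
  𝟙? d = 𝟙 (does d)

  𝟙?-T? : ∀ b → 𝟙? (T? b) ≡ 𝟙 b
  𝟙?-T? true  = refl
  𝟙?-T? false = refl

  𝟙≤1 : ∀ b → 𝟙 b ≤ 1
  𝟙≤1 true  = s≤s z≤n
  𝟙≤1 false = z≤n

  𝟙-∧ : ∀ a b → 𝟙 (a ∧ b) ≡ 𝟙 a * 𝟙 b
  𝟙-∧ true  b = sym (+-identityʳ (𝟙 b))
  𝟙-∧ false b = refl

  module _ {A : Set} where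

    ∑-cong : ∀ (l : List A) {f g : A → ℕ} → (∀ a → f a ≡ g a) → ∑ l f ≡ ∑ l g
    ∑-cong []      f≡g = refl
    ∑-cong (a ∷ l) f≡g = cong₂ _+_ (f≡g a) (∑-cong l f≡g)

    ∑-mono : ∀ (l : List A) {f g : A → ℕ} → (∀ a → f a ≤ g a) → ∑ l f ≤ ∑ l g
    ∑-mono []      f≤g = z≤n
    ∑-mono (a ∷ l) f≤g = +-mono-≤ (f≤g a) (∑-mono l f≤g)

    ∑-+ : ∀ (l : List A) (f g : A → ℕ) →
          ∑[ a ∈ l ] (f a + g a) ≡ ∑ l f + ∑ l g
    ∑-+ []      f g = refl
    ∑-+ (a ∷ l) f g = begin
      (f a + g a) + ∑[ b ∈ l ] (f b + g b) ≡⟨ cong ((f a + g a) +_) (∑-+ l f g) ⟩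
      (f a + g a) + (∑ l f + ∑ l g)        ≡⟨ +-interchange (f a) (g a) _ _ ⟩
      (f a + ∑ l f) + (g a + ∑ l g)        ∎
      where
      +-interchange : ∀ w x y z → (w + x) + (y + z) ≡ (w + y) + (x + z)
      +-interchange = solve-∀

    ∑-*ˡ : ∀ (l : List A) (c : ℕ) (f : A → ℕ) → ∑[ a ∈ l ] (c * f a) ≡ c * ∑ l f
    ∑-*ˡ []      c f = sym (*-zeroʳ c)
    ∑-*ˡ (a ∷ l) c f = trans (cong (c * f a +_) (∑-*ˡ l c f)) (sym (*-distribˡ-+ c (f a) (∑ l f)))

    ∑-*ʳ : ∀ (l : List A) (c : ℕ) (f : A → ℕ) → ∑[ a ∈ l ] (f a * c) ≡ ∑ l f * c
    ∑-*ʳ l c f = begin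
      ∑[ a ∈ l ] (f a * c) ≡⟨ ∑-cong l (λ a → *-comm (f a) c) ⟩
      ∑[ a ∈ l ] (c * f a) ≡⟨ ∑-*ˡ l c f ⟩
      c * ∑ l f            ≡⟨ *-comm c (∑ l f) ⟩
      ∑ l f * c            ∎

    ∑-const : ∀ (l : List A) (c : ℕ) → ∑[ _ ∈ l ] c ≡ length l * c
    ∑-const []      c = refl
    ∑-const (a ∷ l) c = cong (c +_) (∑-const l c)

    ∑-zero : ∀ (l : List A) → ∑[ _ ∈ l ] 0 ≡ 0
    ∑-zero l = trans (∑-const l 0) (*-zeroʳ (length l))

    length≡∑1 : ∀ (l : List A) → length l ≡ ∑[ _ ∈ l ] 1
    length≡∑1 l = sym (trans (∑-const l 1) (*-identityʳ (length l)))

    ∑-++ : ∀ (l₁ l₂ : List A) (f : A → ℕ) → ∑ (l₁ ++ l₂) f ≡ ∑ l₁ f + ∑ l₂ f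
    ∑-++ []       l₂ f = refl
    ∑-++ (a ∷ l₁) l₂ f = trans (cong (f a +_) (∑-++ l₁ l₂ f)) (sym (+-assoc (f a) _ _))

    length-filter : ∀ {P : A → Set} (P? : Decidable P) (l : List A) →
                    length (filter P? l) ≡ ∑[ a ∈ l ] 𝟙? (P? a)
    length-filter P? []      = refl
    length-filter P? (a ∷ l) with does (P? a)
    ... | true  = cong suc (length-filter P? l)
    ... | false = length-filter P? l

    ∑-filter : ∀ {P : A → Set} (P? : Decidable P) (l : List A) (f : A → ℕ) →
               ∑ (filter P? l) f ≡ ∑[ a ∈ l ] (𝟙? (P? a) * f a)
    ∑-filter P? []      f = refl
    ∑-filter P? (a ∷ l) f with does (P? a)
    ... | true  = cong₂ _+_ (sym (+-identityʳ (f a))) (∑-filter P? l f)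
    ... | false = ∑-filter P? l f

  module _ {A B : Set} where

    ∑-map : ∀ (h : A → B) (l : List A) (f : B → ℕ) → ∑ (map h l) f ≡ ∑[ a ∈ l ] f (h a)
    ∑-map h []      f = refl
    ∑-map h (a ∷ l) f = cong (f (h a) +_) (∑-map h l f)

    ∑-concatMap : ∀ (h : A → List B) (l : List A) (f : B → ℕ) →
                  ∑ (concatMap h l) f ≡ ∑[ a ∈ l ] ∑ (h a) f
    ∑-concatMap h []      f = refl
    ∑-concatMap h (a ∷ l) f =
      trans (∑-++ (h a) (concatMap h l) f) (cong (∑ (h a) f +_) (∑-concatMap h l f))

    ∑-swap : ∀ (l₁ : List A) (l₂ : List B) (f : A → B → ℕ) →
             ∑[ a ∈ l₁ ] ∑[ b ∈ l₂ ] f a b ≡ ∑[ b ∈ l₂ ] ∑[ a ∈ l₁ ] f a b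
    ∑-swap []       l₂ f = sym (∑-zero l₂)
    ∑-swap (a ∷ l₁) l₂ f =
      trans (cong (∑ l₂ (f a) +_) (∑-swap l₁ l₂ f)) (sym (∑-+ l₂ (f a) _))

module Enumerations where
  open import Data.Nat using (ℕ; zero; suc; _+_; _*_; _^_)
  open import Data.Nat.Properties using (*-identityʳ; *-identityˡ)
  open import Data.Bool using (_∧_)
  open import Data.List using (List; length; allFin)
  open import Data.List.Properties using (map-tabulate)
  open import Data.Vec as Vec using (Vec; []; _∷_)
  import Data.Vec.Properties as Vec
  open import Data.Fin as Fin using (Fin)
  open import Function using (id)
  open import Relation.Nullary using (does; yes; no)
  open import Relation.Binary.Definitions using (DecidableEquality)
  open import Relation.Binary.PropositionalEquality
  open ≡-Reasoning
  open FiniteSums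

  module _ {A : Set} (_≟_ : DecidableEquality A) where

    record Enumerates (l : List A) : Set where
      field occurs-once : ∀ t → ∑[ a ∈ l ] 𝟙? (t ≟ a) ≡ 1
    open Enumerates public

    sift : ∀ {l} → Enumerates l → ∀ t (h : A → ℕ) → ∑[ a ∈ l ] (𝟙? (t ≟ a) * h a) ≡ h t
    sift {l} once t h = begin
      ∑[ a ∈ l ] (𝟙? (t ≟ a) * h a) ≡⟨ ∑-cong l deltaMoves ⟩
      ∑[ a ∈ l ] (𝟙? (t ≟ a) * h t) ≡⟨ ∑-*ʳ l (h t) _ ⟩
      ∑[ a ∈ l ] 𝟙? (t ≟ a) * h t   ≡⟨ cong (_* h t) (occurs-once once t) ⟩
      1 * h t                       ≡⟨ *-identityˡ (h t) ⟩
      h t                           ∎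
      where
      deltaMoves : ∀ a → 𝟙? (t ≟ a) * h a ≡ 𝟙? (t ≟ a) * h t
      deltaMoves a with t ≟ a
      ... | yes refl = refl
      ... | no  _    = refl

  ∑-allFin-suc : ∀ n (f : Fin (suc n) → ℕ) →
                 ∑[ x ∈ allFin (suc n) ] f x ≡ f Fin.zero + ∑[ x ∈ allFin n ] f (Fin.suc x)
  ∑-allFin-suc n f = cong (f Fin.zero +_)
    (trans (cong (λ l → ∑ l f) (sym (map-tabulate id Fin.suc))) (∑-map Fin.suc (allFin n) f))

  allFin-enumerates : ∀ n → Enumerates Fin._≟_ (allFin n)
  occurs-once (allFin-enumerates (suc n)) Fin.zero    =
    trans (∑-allFin-suc n (λ a → 𝟙? (Fin.zero Fin.≟ a))) (cong suc (∑-zero (allFin n)))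
  occurs-once (allFin-enumerates (suc n)) (Fin.suc t) =
    trans (∑-allFin-suc n (λ a → 𝟙? (Fin.suc t Fin.≟ a))) (occurs-once (allFin-enumerates n) t)

  module _ {A : Set} where

    ∑-tuples-suc : ∀ j (l : List A) (f : Vec A (suc j) → ℕ) →
                   ∑ (tuples (suc j) l) f ≡ ∑[ a ∈ l ] ∑[ as ∈ tuples j l ] f (a ∷ as)
    ∑-tuples-suc j l f =
      trans (∑-concatMap _ l f) (∑-cong l (λ a → ∑-map (a ∷_) (tuples j l) f))

    length-tuples : ∀ j (l : List A) → length (tuples j l) ≡ length l ^ j
    length-tuples zero    l = refl
    length-tuples (suc j) l = begin
      length (tuples (suc j) l)                   ≡⟨ length≡∑1 (tuples (suc j) l) ⟩
      ∑[ _ ∈ tuples (suc j) l ] 1                 ≡⟨ ∑-tuples-suc j l _ ⟩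
      ∑[ _ ∈ l ] ∑[ _ ∈ tuples j l ] 1            ≡⟨ ∑-cong l (λ _ → sym (length≡∑1 (tuples j l))) ⟩
      ∑[ _ ∈ l ] length (tuples j l)              ≡⟨ ∑-const l _ ⟩
      length l * length (tuples j l)              ≡⟨ cong (length l *_) (length-tuples j l) ⟩
      length l * length l ^ j                     ∎

    tuples-enumerates : ∀ j (_≟_ : DecidableEquality A) {l : List A} → Enumerates _≟_ l →
                        Enumerates (Vec.≡-dec _≟_) (tuples j l)
    occurs-once (tuples-enumerates zero    _≟_ once) []       = refl
    occurs-once (tuples-enumerates (suc j) _≟_ {l} once) (t ∷ ts) = begin
      ∑[ as ∈ tuples (suc j) l ] 𝟙? (Vec.≡-dec _≟_ (t ∷ ts) as)
        ≡⟨ ∑-tuples-suc j l (λ as → 𝟙? (Vec.≡-dec _≟_ (t ∷ ts) as)) ⟩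
      ∑[ a ∈ l ] ∑[ as ∈ tuples j l ] 𝟙 (does (t ≟ a) ∧ does (Vec.≡-dec _≟_ ts as))
        ≡⟨ ∑-cong l splitHead ⟩
      ∑[ a ∈ l ] 𝟙? (t ≟ a)
        ≡⟨ occurs-once once t ⟩
      1 ∎
      where
      splitHead : ∀ a → ∑[ as ∈ tuples j l ] 𝟙 (does (t ≟ a) ∧ does (Vec.≡-dec _≟_ ts as))
                        ≡ 𝟙? (t ≟ a)
      splitHead a = begin
        ∑[ as ∈ tuples j l ] 𝟙 (does (t ≟ a) ∧ does (Vec.≡-dec _≟_ ts as))
          ≡⟨ ∑-cong (tuples j l) (λ as → 𝟙-∧ (does (t ≟ a)) _) ⟩
        ∑[ as ∈ tuples j l ] (𝟙? (t ≟ a) * 𝟙? (Vec.≡-dec _≟_ ts as))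
          ≡⟨ ∑-*ˡ (tuples j l) (𝟙? (t ≟ a)) (λ as → 𝟙? (Vec.≡-dec _≟_ ts as)) ⟩
        𝟙? (t ≟ a) * ∑[ as ∈ tuples j l ] 𝟙? (Vec.≡-dec _≟_ ts as)
          ≡⟨ cong (𝟙? (t ≟ a) *_) (occurs-once (tuples-enumerates j _≟_ once) ts) ⟩
        𝟙? (t ≟ a) * 1
          ≡⟨ *-identityʳ (𝟙? (t ≟ a)) ⟩
        𝟙? (t ≟ a) ∎

module DoubleCounting where
  open import Data.Nat using (ℕ; zero; suc; _*_)
  open import Data.Nat.Properties using (*-comm; *-assoc; *-identityʳ; *-identityˡ)
  open import Data.Nat.Tactic.RingSolver using (solve-∀)
  open import Data.Bool using (Bool; true; false)
  open import Data.List using (List; length; filter; allFin)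
  open import Data.Vec using ([]; _∷_; tabulate)
  open import Data.Fin as Fin using (Fin)
  open import Data.Fin.Subset using (Subset; ∣_∣)
  open import Data.Fin.Subset.Properties using (_∈?_)
  open import Relation.Nullary using (does)
  open import Relation.Binary.Definitions using (DecidableEquality)
  open import Relation.Binary.PropositionalEquality
  open ≡-Reasoning
  open FiniteSums
  open Enumerations

  module _ {E A : Set} (_≟_ : DecidableEquality A) {la : List A} (enumA : Enumerates _≟_ la)
           (p : E → A) where

    ∑-by-degree : ∀ (l : List E) (h : A → ℕ) →
                  ∑[ e ∈ l ] h (p e) ≡ ∑[ x ∈ la ] (h x * length (filter (λ e → p e ≟ x) l))
    ∑-by-degree l h = begin
      ∑[ e ∈ l ] h (p e)                          ≡⟨ ∑-cong l (λ e → sym (sift _≟_ enumA (p e) h)) ⟩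
      ∑[ e ∈ l ] ∑[ x ∈ la ] (𝟙? (p e ≟ x) * h x) ≡⟨ ∑-swap l la (λ e x → 𝟙? (p e ≟ x) * h x) ⟩
      ∑[ x ∈ la ] ∑[ e ∈ l ] (𝟙? (p e ≟ x) * h x) ≡⟨ ∑-cong la weightByDegree ⟩
      ∑[ x ∈ la ] (h x * length (filter (λ e → p e ≟ x) l)) ∎
      where
      weightByDegree : ∀ x → ∑[ e ∈ l ] (𝟙? (p e ≟ x) * h x) ≡ h x * length (filter (λ e → p e ≟ x) l)
      weightByDegree x = begin
        ∑[ e ∈ l ] (𝟙? (p e ≟ x) * h x) ≡⟨ ∑-*ʳ l (h x) (λ e → 𝟙? (p e ≟ x)) ⟩
        ∑[ e ∈ l ] 𝟙? (p e ≟ x) * h x   ≡⟨ cong (_* h x) (sym (length-filter (λ e → p e ≟ x) l)) ⟩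
        length (filter (λ e → p e ≟ x) l) * h x ≡⟨ *-comm _ (h x) ⟩
        h x * length (filter (λ e → p e ≟ x) l) ∎

    ∑-by-regular-degree : ∀ (l : List E) (d : ℕ) → (∀ x → length (filter (λ e → p e ≟ x) l) ≡ d) →
                          ∀ (h : A → ℕ) → ∑[ e ∈ l ] h (p e) ≡ ∑ la h * d
    ∑-by-regular-degree l d regular h = begin
      ∑[ e ∈ l ] h (p e)  ≡⟨ ∑-by-degree l h ⟩
      ∑[ x ∈ la ] (h x * length (filter (λ e → p e ≟ x) l)) ≡⟨ ∑-cong la (λ x → cong (h x *_) (regular x)) ⟩
      ∑[ x ∈ la ] (h x * d) ≡⟨ ∑-*ʳ la d h ⟩
      ∑ la h * d          ∎

  module _ {E A B : Set} (_≟A_ : DecidableEquality A) (_≟B_ : DecidableEquality B)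
           (p : E → A) (q : E → B) where

    inCell : E → A → B → ℕ
    inCell e α β = 𝟙? (p e ≟A α) * 𝟙? (q e ≟B β)

    module _ {la : List A} {lb : List B} (enumA : Enumerates _≟A_ la) (enumB : Enumerates _≟B_ lb) where

      ∑-row : ∀ e α → ∑[ β ∈ lb ] inCell e α β ≡ 𝟙? (p e ≟A α)
      ∑-row e α = begin
        ∑[ β ∈ lb ] (𝟙? (p e ≟A α) * 𝟙? (q e ≟B β)) ≡⟨ ∑-*ˡ lb (𝟙? (p e ≟A α)) (λ β → 𝟙? (q e ≟B β)) ⟩
        𝟙? (p e ≟A α) * ∑[ β ∈ lb ] 𝟙? (q e ≟B β)   ≡⟨ cong (𝟙? (p e ≟A α) *_) (occurs-once enumB (q e)) ⟩
        𝟙? (p e ≟A α) * 1                          ≡⟨ *-identityʳ _ ⟩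
        𝟙? (p e ≟A α)                              ∎

      ∑-column : ∀ e β → ∑[ α ∈ la ] inCell e α β ≡ 𝟙? (q e ≟B β)
      ∑-column e β = begin
        ∑[ α ∈ la ] (𝟙? (p e ≟A α) * 𝟙? (q e ≟B β)) ≡⟨ ∑-*ʳ la (𝟙? (q e ≟B β)) (λ α → 𝟙? (p e ≟A α)) ⟩
        ∑[ α ∈ la ] 𝟙? (p e ≟A α) * 𝟙? (q e ≟B β)   ≡⟨ cong (_* 𝟙? (q e ≟B β)) (occurs-once enumA (p e)) ⟩
        1 * 𝟙? (q e ≟B β)                          ≡⟨ *-identityˡ _ ⟩
        𝟙? (q e ≟B β)                              ∎

      ∑-cells-of-item : ∀ e (h : A → B → ℕ) → ∑[ α ∈ la ] ∑[ β ∈ lb ] (inCell e α β * h α β) ≡ h (p e) (q e)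
      ∑-cells-of-item e h = begin
        ∑[ α ∈ la ] ∑[ β ∈ lb ] (inCell e α β * h α β)
          ≡⟨ ∑-cong la (λ α → trans (∑-cong lb (λ β → *-assoc (𝟙? (p e ≟A α)) _ _))
                                     (∑-*ˡ lb (𝟙? (p e ≟A α)) (λ β → 𝟙? (q e ≟B β) * h α β))) ⟩
        ∑[ α ∈ la ] (𝟙? (p e ≟A α) * ∑[ β ∈ lb ] (𝟙? (q e ≟B β) * h α β))
          ≡⟨ ∑-cong la (λ α → cong (𝟙? (p e ≟A α) *_) (sift _≟B_ enumB (q e) (h α))) ⟩
        ∑[ α ∈ la ] (𝟙? (p e ≟A α) * h α (q e))
          ≡⟨ sift _≟A_ enumA (p e) (λ α → h α (q e)) ⟩
        h (p e) (q e) ∎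

      ∑-by-cells : ∀ (l : List E) (Φ : A → B → ℕ) (K : E → ℕ) →
                   ∑[ e ∈ l ] (Φ (p e) (q e) * K e)
                   ≡ ∑[ α ∈ la ] ∑[ β ∈ lb ] (Φ α β * ∑[ e ∈ l ] (inCell e α β * K e))
      ∑-by-cells l Φ K = begin
        ∑[ e ∈ l ] (Φ (p e) (q e) * K e)
          ≡⟨ ∑-cong l (λ e → sym (∑-cells-of-item e (λ α β → Φ α β * K e))) ⟩
        ∑[ e ∈ l ] ∑[ α ∈ la ] ∑[ β ∈ lb ] (inCell e α β * (Φ α β * K e))
          ≡⟨ ∑-swap l la (λ e α → ∑[ β ∈ lb ] (inCell e α β * (Φ α β * K e))) ⟩
        ∑[ α ∈ la ] ∑[ e ∈ l ] ∑[ β ∈ lb ] (inCell e α β * (Φ α β * K e))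
          ≡⟨ ∑-cong la (λ α → ∑-swap l lb (λ e β → inCell e α β * (Φ α β * K e))) ⟩
        ∑[ α ∈ la ] ∑[ β ∈ lb ] ∑[ e ∈ l ] (inCell e α β * (Φ α β * K e))
          ≡⟨ ∑-cong la (λ α → ∑-cong lb (λ β →
               trans (∑-cong l (λ e → *-left-comm (inCell e α β) (Φ α β) (K e)))
                     (∑-*ˡ l (Φ α β) (λ e → inCell e α β * K e)))) ⟩
        ∑[ α ∈ la ] ∑[ β ∈ lb ] (Φ α β * ∑[ e ∈ l ] (inCell e α β * K e)) ∎
        where
        *-left-comm : ∀ x y z → x * (y * z) ≡ y * (x * z)
        *-left-comm = solve-∀

  mem-tabulate : ∀ {n} (P : Fin n → Bool) (x : Fin n) → does (x ∈? tabulate P) ≡ P x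
  mem-tabulate {suc n} P Fin.zero with P Fin.zero
  ... | true  = refl
  ... | false = refl
  mem-tabulate {suc n} P (Fin.suc x) = mem-tabulate (λ i → P (Fin.suc i)) x

  ∣∣≡∑ : ∀ {n} (S : Subset n) → ∣ S ∣ ≡ ∑[ x ∈ allFin n ] 𝟙? (x ∈? S)
  ∣∣≡∑ {zero}  []          = refl
  ∣∣≡∑ {suc n} (true ∷ S)  = trans (cong suc (∣∣≡∑ S)) (sym (∑-allFin-suc n (λ x → 𝟙? (x ∈? true ∷ S))))
  ∣∣≡∑ {suc n} (false ∷ S) = trans (∣∣≡∑ S) (sym (∑-allFin-suc n (λ x → 𝟙? (x ∈? false ∷ S))))

module NatEmbedding where
  open import Data.Nat as ℕ using (ℕ; zero; suc)
  import Data.Nat.Coprimality as Coprime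
  open import Data.Integer as ℤ using (+_; +≤+)
  import Data.Integer.Properties as ℤ
  open import Data.Rational
  open import Data.Rational.Properties
  open import Data.Rational.Solver using (module +-*-Solver)
  open +-*-Solver using (solve; _:+_; _:*_; _:=_; con)
  import Data.Rational.Unnormalised as ℚᵘ
  import Data.Rational.Unnormalised.Properties as ℚᵘ
  open import Data.List using (List; []; _∷_; length)
  open import Relation.Binary.PropositionalEquality
  open import Defs using (ℕ→ℚ; _^ℚ_)
  open FiniteSums using (∑)

  -- ℕ→ℚ n is the fraction n/1, already in lowest terms.
  toℚᵘ-ℕ→ℚ : ∀ n → toℚᵘ (ℕ→ℚ n) ≡ ℚᵘ.mkℚᵘ (+ n) 0
  toℚᵘ-ℕ→ℚ n rewrite normalize-coprime {n} {0} (Coprime.sym (Coprime.1-coprimeTo n)) = refl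

  transfer : ∀ (_∙_ : ℚ → ℚ → ℚ) (_∙ᵘ_ : ℚᵘ.ℚᵘ → ℚᵘ.ℚᵘ → ℚᵘ.ℚᵘ) →
             (∀ p q → toℚᵘ (p ∙ q) ℚᵘ.≃ (toℚᵘ p ∙ᵘ toℚᵘ q)) →
             ∀ k m n → ℚᵘ.mkℚᵘ (+ k) 0 ℚᵘ.≃ (ℚᵘ.mkℚᵘ (+ m) 0 ∙ᵘ ℚᵘ.mkℚᵘ (+ n) 0) →
             ℕ→ℚ k ≡ ℕ→ℚ m ∙ ℕ→ℚ n
  transfer _∙_ _∙ᵘ_ homo k m n k≃m∙n = toℚᵘ-injective (ℚᵘ.≃-trans (ℚᵘ.≃-reflexive (toℚᵘ-ℕ→ℚ k))
    (ℚᵘ.≃-trans k≃m∙n (ℚᵘ.≃-sym (ℚᵘ.≃-trans (homo (ℕ→ℚ m) (ℕ→ℚ n))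
      (ℚᵘ.≃-reflexive (cong₂ _∙ᵘ_ (toℚᵘ-ℕ→ℚ m) (toℚᵘ-ℕ→ℚ n)))))))

  ℕ→ℚ-+ : ∀ m n → ℕ→ℚ (m ℕ.+ n) ≡ ℕ→ℚ m + ℕ→ℚ n
  ℕ→ℚ-+ m n = transfer _+_ ℚᵘ._+_ toℚᵘ-homo-+ (m ℕ.+ n) m n (ℚᵘ.*≡* (begin
    + (m ℕ.+ n) ℤ.* + 1                               ≡⟨ ℤ.*-identityʳ _ ⟩
    + (m ℕ.+ n)                                       ≡⟨ ℤ.pos-+ m n ⟩
    + m ℤ.+ + n                                       ≡⟨ cong₂ ℤ._+_ (ℤ.*-identityʳ (+ m)) (ℤ.*-identityʳ (+ n)) ⟨
    (+ m ℤ.* + 1 ℤ.+ + n ℤ.* + 1)                     ≡⟨ ℤ.*-identityʳ _ ⟨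
    (+ m ℤ.* + 1 ℤ.+ + n ℤ.* + 1) ℤ.* + 1             ∎))
    where open ≡-Reasoning

  ℕ→ℚ-* : ∀ m n → ℕ→ℚ (m ℕ.* n) ≡ ℕ→ℚ m * ℕ→ℚ n
  ℕ→ℚ-* m n = transfer _*_ ℚᵘ._*_ toℚᵘ-homo-* (m ℕ.* n) m n
    (ℚᵘ.*≡* (cong (ℤ._* + 1) (ℤ.pos-* m n)))

  ℕ→ℚ-^ : ∀ a p → ℕ→ℚ (a ℕ.^ p) ≡ ℕ→ℚ a ^ℚ p
  ℕ→ℚ-^ a zero    = refl
  ℕ→ℚ-^ a (suc p) = trans (ℕ→ℚ-* a (a ℕ.^ p)) (cong (ℕ→ℚ a *_) (ℕ→ℚ-^ a p))

  ℕ→ℚ-mono-≤ : ∀ {m n} → m ℕ.≤ n → ℕ→ℚ m ≤ ℕ→ℚ n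
  ℕ→ℚ-mono-≤ {m} {n} m≤n = toℚᵘ-cancel-≤ (subst₂ ℚᵘ._≤_ (sym (toℚᵘ-ℕ→ℚ m)) (sym (toℚᵘ-ℕ→ℚ n))
    (ℚᵘ.*≤* (subst₂ ℤ._≤_ (sym (ℤ.*-identityʳ (+ m))) (sym (ℤ.*-identityʳ (+ n))) (+≤+ m≤n))))

  ℕ→ℚ-nonNeg : ∀ n → 0ℚ ≤ ℕ→ℚ n
  ℕ→ℚ-nonNeg n = ℕ→ℚ-mono-≤ (ℕ.z≤n {n})

  ℕ→ℚ-pos : ∀ {n} → 0 ℕ.< n → 0ℚ < ℕ→ℚ n
  ℕ→ℚ-pos 0<n = <-≤-trans (*<* (ℤ.+<+ (ℕ.s≤s ℕ.z≤n))) (ℕ→ℚ-mono-≤ 0<n)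

  *-monoˡ-≤-0≤ : ∀ r {p q} → 0ℚ ≤ r → p ≤ q → r * p ≤ r * q
  *-monoˡ-≤-0≤ r 0≤r = *-monoˡ-≤-nonNeg r {{nonNegative 0≤r}}

  *-monoʳ-≤-0≤ : ∀ r {p q} → 0ℚ ≤ r → p ≤ q → p * r ≤ q * r
  *-monoʳ-≤-0≤ r 0≤r = *-monoʳ-≤-nonNeg r {{nonNegative 0≤r}}

  0≤* : ∀ {p q} → 0ℚ ≤ p → 0ℚ ≤ q → 0ℚ ≤ p * q
  0≤* {p} 0≤p 0≤q = ≤-trans (≤-reflexive (sym (*-zeroʳ p))) (*-monoˡ-≤-0≤ p 0≤p 0≤q)

  module _ {A : Set} where

    ∑-affine-bound : ∀ (l : List A) (c : ℚ) (f g r : A → ℕ) →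
                     (∀ a → ℕ→ℚ (f a) ≤ c * ℕ→ℚ (g a) + ℕ→ℚ (r a)) →
                     ℕ→ℚ (∑ l f) ≤ c * ℕ→ℚ (∑ l g) + ℕ→ℚ (∑ l r)
    ∑-affine-bound []      c f g r bound = ≤-reflexive (solve 1 (λ c → con 0ℚ := c :* con 0ℚ :+ con 0ℚ) refl c)
    ∑-affine-bound (a ∷ l) c f g r bound = begin
      ℕ→ℚ (f a ℕ.+ ∑ l f)
        ≡⟨ ℕ→ℚ-+ (f a) (∑ l f) ⟩
      ℕ→ℚ (f a) + ℕ→ℚ (∑ l f)
        ≤⟨ +-mono-≤ (bound a) (∑-affine-bound l c f g r bound) ⟩
      (c * ℕ→ℚ (g a) + ℕ→ℚ (r a)) + (c * ℕ→ℚ (∑ l g) + ℕ→ℚ (∑ l r))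
        ≡⟨ affine-+ c (ℕ→ℚ (g a)) (ℕ→ℚ (∑ l g)) (ℕ→ℚ (r a)) (ℕ→ℚ (∑ l r)) ⟩
      c * (ℕ→ℚ (g a) + ℕ→ℚ (∑ l g)) + (ℕ→ℚ (r a) + ℕ→ℚ (∑ l r))
        ≡⟨ cong₂ (λ x y → c * x + y) (ℕ→ℚ-+ (g a) (∑ l g)) (ℕ→ℚ-+ (r a) (∑ l r)) ⟨
      c * ℕ→ℚ (g a ℕ.+ ∑ l g) + ℕ→ℚ (r a ℕ.+ ∑ l r) ∎
      where
      open ≤-Reasoning
      affine-+ : ∀ c x y u w → (c * x + u) + (c * y + w) ≡ c * (x + y) + (u + w)
      affine-+ = solve 5 (λ c x y u w → (c :* x :+ u) :+ (c :* y :+ w) := c :* (x :+ y) :+ (u :+ w)) refl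

    ∑-bound : ∀ (l : List A) (q : ℚ) (f : A → ℕ) → (∀ a → ℕ→ℚ (f a) ≤ q) →
              ℕ→ℚ (∑ l f) ≤ ℕ→ℚ (length l) * q
    ∑-bound []      q f bound = ≤-reflexive (sym (*-zeroˡ q))
    ∑-bound (a ∷ l) q f bound = begin
      ℕ→ℚ (f a ℕ.+ ∑ l f)         ≡⟨ ℕ→ℚ-+ (f a) (∑ l f) ⟩
      ℕ→ℚ (f a) + ℕ→ℚ (∑ l f)     ≤⟨ +-mono-≤ (bound a) (∑-bound l q f bound) ⟩
      q + ℕ→ℚ (length l) * q      ≡⟨ solve 2 (λ q L → q :+ L :* q := (con 1ℚ :+ L) :* q) refl q (ℕ→ℚ (length l)) ⟩
      (1ℚ + ℕ→ℚ (length l)) * q   ≡⟨ cong (_* q) (ℕ→ℚ-+ 1 (length l)) ⟨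
      ℕ→ℚ (suc (length l)) * q    ∎
      where open ≤-Reasoning

  error-step : ∀ {c ε} j → 0ℚ ≤ ε → c ≤ 1ℚ →
               c * (c ^ℚ j + ℕ→ℚ j * ε) + ε ≤ c ^ℚ suc j + ℕ→ℚ (suc j) * ε
  error-step {c} {ε} j 0≤ε c≤1 = begin
    c * (c ^ℚ j + ℕ→ℚ j * ε) + ε        ≡⟨ expand c (c ^ℚ j) (ℕ→ℚ j * ε) ε ⟩
    c * c ^ℚ j + (c * (ℕ→ℚ j * ε) + ε)  ≤⟨ +-monoʳ-≤ (c * c ^ℚ j) (+-monoˡ-≤ ε
                                             (*-monoʳ-≤-0≤ (ℕ→ℚ j * ε) (0≤* (ℕ→ℚ-nonNeg j) 0≤ε) c≤1)) ⟩
    c * c ^ℚ j + (1ℚ * (ℕ→ℚ j * ε) + ε) ≡⟨ collect (c * c ^ℚ j) (ℕ→ℚ j) ε ⟩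
    c * c ^ℚ j + (1ℚ + ℕ→ℚ j) * ε       ≡⟨ cong (λ n → c * c ^ℚ j + n * ε) (ℕ→ℚ-+ 1 j) ⟨
    c * c ^ℚ j + ℕ→ℚ (suc j) * ε        ∎
    where
    open ≤-Reasoning
    expand : ∀ c p q ε → c * (p + q) + ε ≡ c * p + (c * q + ε)
    expand = solve 4 (λ c p q ε → c :* (p :+ q) :+ ε := c :* p :+ (c :* q :+ ε)) refl
    collect : ∀ x n ε → x + (1ℚ * (n * ε) + ε) ≡ x + (1ℚ + n) * ε
    collect = solve 3 (λ x n ε → x :+ (con 1ℚ :* (n :* ε) :+ ε) := x :+ (con 1ℚ :+ n) :* ε) refl

  ^ℚ-≥1 : ∀ {c} → 1ℚ ≤ c → ∀ n → 1ℚ ≤ c ^ℚ n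
  ^ℚ-≥1 1≤c zero    = ≤-refl
  ^ℚ-≥1 {c} 1≤c (suc n) = begin
    1ℚ            ≡⟨ *-identityʳ 1ℚ ⟨
    1ℚ * 1ℚ       ≤⟨ *-monoʳ-≤-0≤ 1ℚ 0≤1 1≤c ⟩
    c * 1ℚ        ≤⟨ *-monoˡ-≤-0≤ c (≤-trans 0≤1 1≤c) (^ℚ-≥1 1≤c n) ⟩
    c * c ^ℚ n    ∎
    where
    open ≤-Reasoning
    0≤1 : 0ℚ ≤ 1ℚ
    0≤1 = ℕ→ℚ-nonNeg 1

module Values where
  open import Data.Nat as ℕ using ()
  open import Data.Rational using (_≤_; _*_)
  open import Data.Rational.Properties using (*-cancelʳ-≤-pos; ≤-trans; ≤-reflexive; *-zeroˡ)
  open import Data.Rational.Base using (positive)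
  open import Data.Product using (_,_)
  open import Relation.Binary.PropositionalEquality
  open NatEmbedding

  module _ {X Y ΣX ΣY : Set} (G : Game X Y ΣX ΣY) (hasEdge : 0 ℕ.< numEdges G) where

    cancel-edges : ∀ {p q} → p * ℕ→ℚ (numEdges G) ≤ q * ℕ→ℚ (numEdges G) → p ≤ q
    cancel-edges = *-cancelʳ-≤-pos (ℕ→ℚ (numEdges G)) {{positive (ℕ→ℚ-pos hasEdge)}}

    value-≤ : ∀ {w} → IsVal G w → ∀ q → ValLe G q → w ≤ q
    value-≤ (_ , f , g , attained) q bounded =
      cancel-edges (subst (_≤ q * ℕ→ℚ (numEdges G)) attained (bounded f g))

    value-nonNeg : ∀ {w} → IsVal G w → 0ℚ ≤ w
    value-nonNeg {w} (_ , f , g , attained) =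
      cancel-edges (≤-trans (≤-reflexive (*-zeroˡ (ℕ→ℚ (numEdges G))))
                            (subst (0ℚ ≤_) attained (ℕ→ℚ-nonNeg (accCount G f g))))

module RobustGame {nX nY aX aY : ℕ} (G : Game (Fin nX) (Fin nY) (Fin aX) (Fin aY))
  (v ε δ : ℚ) (isVal : IsVal G v) (robust : Robust G δ ε)
  (dX dY : ℕ) (regularX : ∀ x → degX G x ≡ dX) (regularY : ∀ y → degY G y ≡ dY)
  (0≤c : 0ℚ ℚ.≤ v ℚ.+ ε) (0≤δ : 0ℚ ℚ.≤ δ) where

  open import Data.Nat as ℕ using (zero; suc; z≤n; s≤s) renaming (_≤_ to _≤ℕ_)
  import Data.Nat.Properties as ℕ
  open import Data.Bool using (Bool; true; false)
  open import Data.Bool.Properties using (T?)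
  open import Data.List using (List; _∷_; length; filter; allFin)
  open import Data.List.Properties using (length-tabulate; length-map)
  open import Data.Vec as Vec using (Vec; []; _∷_; tabulate)
  import Data.Vec.Properties as Vec
  import Data.Fin as Fin
  open import Data.Fin.Subset using (Subset; _∈_; ∣_∣)
  open import Data.Fin.Subset.Properties using (_∈?_)
  open import Data.Product using (_×_; _,_)
  open import Data.Sum using ([_,_]′)
  open import Function using (id)
  open import Relation.Nullary using (Dec; yes; no; does; ¬?)
  open import Relation.Nullary.Decidable using (_×-dec_)
  open import Relation.Binary.Definitions using (DecidableEquality)
  open import Relation.Binary.PropositionalEquality
  open import Data.Rational using (1ℚ; _≤_; _+_; _*_; _≤?_)
  open import Data.Rational.Properties
  open FiniteSums
  open Enumerations
  open DoubleCounting
  open NatEmbedding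
  open Values
  open import Data.Rational.Solver using (module +-*-Solver)
  open +-*-Solver using (solve; _:+_; _:*_; _:=_; con)

  Edge : Set
  Edge = Fin nX × Fin nY × (Fin aX → Fin aY → Bool)

  constraint : Edge → Fin aX → Fin aY → Bool
  constraint (_ , _ , ψ) = ψ

  E : List Edge
  E = edges G

  m : ℕ
  m = numEdges G

  c : ℚ
  c = v + ε

  -- Every edge has one endpoint in X, so bi-regularity gives m = |X| · dX (and likewise for Y).
  edges-by-degree : ∀ {n} (end : Edge → Fin n) (d : ℕ) →
                    (∀ x → length (filter (λ e → end e Fin.≟ x) E) ≡ d) → m ≡ n ℕ.* d
  edges-by-degree {n} end d regular = begin
    length E                            ≡⟨ length≡∑1 E ⟩
    ∑[ _ ∈ E ] 1                        ≡⟨ ∑-by-regular-degree Fin._≟_ (allFin-enumerates n) end E d regular (λ _ → 1) ⟩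
    ∑[ _ ∈ allFin n ] 1 ℕ.* d           ≡⟨ cong (ℕ._* d) (sym (length≡∑1 (allFin n))) ⟩
    length (allFin n) ℕ.* d             ≡⟨ cong (ℕ._* d) (length-tabulate {n = n} id) ⟩
    n ℕ.* d                             ∎
    where open ≡-Reasoning

  m≡nX*dX : m ≡ nX ℕ.* dX
  m≡nX*dX = edges-by-degree edgeX dX regularX

  m≡nY*dY : m ≡ nY ℕ.* dY
  m≡nY*dY = edges-by-degree edgeY dY regularY

  -- The bound count ≤ c · size is automatic for an empty subgame, so it suffices to check it
  -- when the subgame has an edge.
  bound-if-nonempty : ∀ {wins size} → wins ≤ℕ size → (0 ℕ.< size → ℕ→ℚ wins ≤ c * ℕ→ℚ size) →
                      ℕ→ℚ wins ≤ c * ℕ→ℚ size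
  bound-if-nonempty {size = zero}  wins≤0 _     = ≤-trans (ℕ→ℚ-mono-≤ wins≤0) (0≤* 0≤c (ℕ→ℚ-nonNeg 0))
  bound-if-nonempty {size = suc _} _      bound = bound (s≤s z≤n)

  robust-count : ∀ (S : Subset nX) (T : Subset nY) → δ * ℕ→ℚ nX ≤ ℕ→ℚ ∣ S ∣ → δ * ℕ→ℚ nY ≤ ℕ→ℚ ∣ T ∣ →
                 ∀ f g → ℕ→ℚ (accCount (restrict G S T) f g) ≤ c * ℕ→ℚ (numEdges (restrict G S T))
  robust-count S T largeS largeT f g =
    bound-if-nonempty (Data.List.Properties.length-filter _ (edges (restrict G S T)))
                      (λ nonempty → robust v isVal S T largeS largeT nonempty f g)

  below-remainder : ∀ {a r} x → a ≤ℕ r → ℕ→ℚ a ≤ c * ℕ→ℚ x + ℕ→ℚ r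
  below-remainder {a} {r} x a≤r = begin
    ℕ→ℚ a               ≤⟨ ℕ→ℚ-mono-≤ a≤r ⟩
    ℕ→ℚ r               ≡⟨ +-identityˡ (ℕ→ℚ r) ⟨
    0ℚ + ℕ→ℚ r          ≤⟨ +-monoˡ-≤ (ℕ→ℚ r) (0≤* 0≤c (ℕ→ℚ-nonNeg x)) ⟩
    c * ℕ→ℚ x + ℕ→ℚ r   ∎
    where open ≤-Reasoning

  -- A cell with a ≤ n accepted edges out of n: if both of its sides are large the robust
  -- bound applies; otherwise the whole cell is charged to a small side.
  robust-or-small : ∀ {PX PY : Set} (largeX? : Dec PX) (largeY? : Dec PY) {a n} → a ≤ℕ n →
                    (PX → PY → ℕ→ℚ a ≤ c * ℕ→ℚ n) →
                    ℕ→ℚ a ≤ c * ℕ→ℚ n + ℕ→ℚ (𝟙? (¬? largeX?) ℕ.* n ℕ.+ 𝟙? (¬? largeY?) ℕ.* n)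
  robust-or-small (yes px) (yes py) {a} {n} _ robustBound = begin
    ℕ→ℚ a                      ≤⟨ robustBound px py ⟩
    c * ℕ→ℚ n                  ≡⟨ +-identityʳ (c * ℕ→ℚ n) ⟨
    c * ℕ→ℚ n + ℕ→ℚ 0          ∎
    where open ≤-Reasoning
  robust-or-small (yes _) (no _) {n = n} a≤n _ = below-remainder n (ℕ.≤-trans a≤n (ℕ.≤-reflexive (sym (ℕ.+-identityʳ n))))
  robust-or-small (no _)  _      {n = n} a≤n _ = below-remainder n (ℕ.≤-trans a≤n (ℕ.≤-trans (ℕ.≤-reflexive (sym (ℕ.+-identityʳ n))) (ℕ.m≤m+n _ _)))

  gate : ∀ o {a n r} → ℕ→ℚ a ≤ c * ℕ→ℚ n + ℕ→ℚ r → ℕ→ℚ (𝟙 o ℕ.* a) ≤ c * ℕ→ℚ (𝟙 o ℕ.* n) + ℕ→ℚ r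
  gate true  {a} {n} bound = subst₂ (λ a′ n′ → ℕ→ℚ a′ ≤ c * ℕ→ℚ n′ + _) (sym (ℕ.*-identityˡ a)) (sym (ℕ.*-identityˡ n)) bound
  gate false {r = r} _ = below-remainder {r = r} 0 z≤n

  edges-into : ∀ {n} (end : Edge → Fin n) (d : ℕ) → (∀ x → length (filter (λ e → end e Fin.≟ x) E) ≡ d) →
               ∀ (S : Subset n) → ∑[ e ∈ E ] 𝟙? (end e ∈? S) ≡ ∣ S ∣ ℕ.* d
  edges-into {n} end d regular S = begin
    ∑[ e ∈ E ] 𝟙? (end e ∈? S)                  ≡⟨ ∑-by-regular-degree Fin._≟_ (allFin-enumerates n) end E d regular (λ x → 𝟙? (x ∈? S)) ⟩
    ∑[ x ∈ allFin n ] 𝟙? (x ∈? S) ℕ.* d         ≡⟨ cong (ℕ._* d) (∣∣≡∑ S) ⟨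
    ∣ S ∣ ℕ.* d                                  ∎
    where open ≡-Reasoning

  small-side : ∀ n d → m ≡ n ℕ.* d → ∀ s (large? : Dec (δ * ℕ→ℚ n ≤ ℕ→ℚ s)) →
               ℕ→ℚ (𝟙? (¬? large?) ℕ.* (s ℕ.* d)) ≤ δ * ℕ→ℚ m
  small-side n d m≡nd s (yes _) = 0≤* 0≤δ (ℕ→ℚ-nonNeg m)
  small-side n d m≡nd s (no small) = begin
    ℕ→ℚ (1 ℕ.* (s ℕ.* d))     ≡⟨ cong ℕ→ℚ (ℕ.*-identityˡ (s ℕ.* d)) ⟩
    ℕ→ℚ (s ℕ.* d)             ≡⟨ ℕ→ℚ-* s d ⟩
    ℕ→ℚ s * ℕ→ℚ d             ≤⟨ *-monoʳ-≤-0≤ (ℕ→ℚ d) (ℕ→ℚ-nonNeg d) (<⇒≤ (≰⇒> small)) ⟩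
    (δ * ℕ→ℚ n) * ℕ→ℚ d       ≡⟨ *-assoc δ (ℕ→ℚ n) (ℕ→ℚ d) ⟩
    δ * (ℕ→ℚ n * ℕ→ℚ d)       ≡⟨ cong (δ *_) (trans (cong ℕ→ℚ m≡nd) (ℕ→ℚ-* n d)) ⟨
    δ * ℕ→ℚ m                 ∎
    where open ≤-Reasoning

  -- Label the questions by φ : X → A and γ : Y → B, and call
  -- an edge compatible when its labels satisfy Φ.  Among compatible edges, the strategies
  -- (f , g) win at most a c-fraction, up to the weight of the cells with a small side.
  module Cells {A B : Set} (_≟A_ : DecidableEquality A) (_≟B_ : DecidableEquality B)
               {la : List A} {lb : List B} (enumA : Enumerates _≟A_ la) (enumB : Enumerates _≟B_ lb)
               (f : Fin nX → Fin aX) (g : Fin nY → Fin aY) (φ : Fin nX → A) (γ : Fin nY → B)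
               (Φ : A → B → Bool) where

    labelX : Edge → A
    labelX e = φ (edgeX e)

    labelY : Edge → B
    labelY e = γ (edgeY e)

    won : Edge → ℕ
    won e = 𝟙 (constraint e (f (edgeX e)) (g (edgeY e)))

    compatible : Edge → ℕ
    compatible e = 𝟙 (Φ (labelX e) (labelY e))

    cell : Edge → A → B → ℕ
    cell = inCell _≟A_ _≟B_ labelX labelY

    fibreX : A → Subset nX
    fibreX α = tabulate (λ x → does (φ x ≟A α))

    fibreY : B → Subset nY
    fibreY β = tabulate (λ y → does (γ y ≟B β))

    cellWins : A → B → ℕ
    cellWins α β = ∑[ e ∈ E ] (cell e α β ℕ.* won e)

    cellSize : A → B → ℕ
    cellSize α β = ∑[ e ∈ E ] cell e α β

    inSubgame? : ∀ α β (e : Edge) → Dec (edgeX e ∈ fibreX α × edgeY e ∈ fibreY β)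
    inSubgame? α β e = (edgeX e ∈? fibreX α) ×-dec (edgeY e ∈? fibreY β)

    in-subgame : ∀ α β e → 𝟙? (inSubgame? α β e) ≡ cell e α β
    in-subgame α β e =
      trans (𝟙-∧ (does (edgeX e ∈? fibreX α)) (does (edgeY e ∈? fibreY β)))
            (cong₂ ℕ._*_ (cong 𝟙 (mem-tabulate (λ x → does (φ x ≟A α)) (edgeX e)))
                         (cong 𝟙 (mem-tabulate (λ y → does (γ y ≟B β)) (edgeY e))))

    subgame-wins : ∀ α β → accCount (restrict G (fibreX α) (fibreY β)) f g ≡ cellWins α β
    subgame-wins α β = begin
      accCount (restrict G (fibreX α) (fibreY β)) f g
        ≡⟨ length-filter (λ e → T? (constraint e (f (edgeX e)) (g (edgeY e)))) (filter (inSubgame? α β) E) ⟩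
      ∑[ e ∈ filter (inSubgame? α β) E ] 𝟙? (T? (constraint e (f (edgeX e)) (g (edgeY e))))
        ≡⟨ ∑-filter (inSubgame? α β) E _ ⟩
      ∑[ e ∈ E ] (𝟙? (inSubgame? α β e) ℕ.* 𝟙? (T? (constraint e (f (edgeX e)) (g (edgeY e)))))
        ≡⟨ ∑-cong E (λ e → cong₂ ℕ._*_ (in-subgame α β e) (𝟙?-T? (constraint e (f (edgeX e)) (g (edgeY e))))) ⟩
      cellWins α β ∎
      where open ≡-Reasoning

    subgame-size : ∀ α β → numEdges (restrict G (fibreX α) (fibreY β)) ≡ cellSize α β
    subgame-size α β = trans (length-filter (inSubgame? α β) E)
                             (∑-cong E (in-subgame α β))

    cellWins≤cellSize : ∀ α β → cellWins α β ≤ℕ cellSize α β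
    cellWins≤cellSize α β = ∑-mono E (λ e → ℕ.≤-trans (ℕ.*-monoʳ-≤ (cell e α β) (𝟙≤1 _))
                                                      (ℕ.≤-reflexive (ℕ.*-identityʳ (cell e α β))))

    largeX? : ∀ α → Dec (δ * ℕ→ℚ nX ≤ ℕ→ℚ ∣ fibreX α ∣)
    largeX? α = δ * ℕ→ℚ nX ≤? ℕ→ℚ ∣ fibreX α ∣

    largeY? : ∀ β → Dec (δ * ℕ→ℚ nY ≤ ℕ→ℚ ∣ fibreY β ∣)
    largeY? β = δ * ℕ→ℚ nY ≤? ℕ→ℚ ∣ fibreY β ∣

    smallX : A → ℕ
    smallX α = 𝟙? (¬? (largeX? α))

    smallY : B → ℕ
    smallY β = 𝟙? (¬? (largeY? β))

    smallWeight : A → B → ℕ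
    smallWeight α β = smallX α ℕ.* cellSize α β ℕ.+ smallY β ℕ.* cellSize α β

    smallCells : ℕ
    smallCells = ∑[ α ∈ la ] ∑[ β ∈ lb ] smallWeight α β

    cell-bound : ∀ α β → ℕ→ℚ (𝟙 (Φ α β) ℕ.* cellWins α β)
                         ≤ c * ℕ→ℚ (𝟙 (Φ α β) ℕ.* cellSize α β)
                           + ℕ→ℚ (smallWeight α β)
    cell-bound α β = gate (Φ α β) {r = smallWeight α β} (robust-or-small (largeX? α) (largeY? β) (cellWins≤cellSize α β)
      (λ largeα largeβ → subst₂ (λ w s → ℕ→ℚ w ≤ c * ℕ→ℚ s) (subgame-wins α β) (subgame-size α β)
                                (robust-count (fibreX α) (fibreY β) largeα largeβ f g)))

    compatible-bound : ℕ→ℚ (∑[ e ∈ E ] (compatible e ℕ.* won e))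
                       ≤ c * ℕ→ℚ (∑[ e ∈ E ] compatible e) + ℕ→ℚ smallCells
    compatible-bound = subst₂ (λ w s → ℕ→ℚ w ≤ c * ℕ→ℚ s + ℕ→ℚ smallCells) (sym wins-by-cells) (sym size-by-cells)
      (∑-affine-bound la c _ _ _ (λ α → ∑-affine-bound lb c _ _ _ (λ β → cell-bound α β)))
      where
      Φ₁ : A → B → ℕ
      Φ₁ α β = 𝟙 (Φ α β)
      wins-by-cells : ∑[ e ∈ E ] (compatible e ℕ.* won e) ≡ ∑[ α ∈ la ] ∑[ β ∈ lb ] (Φ₁ α β ℕ.* cellWins α β)
      wins-by-cells = ∑-by-cells _≟A_ _≟B_ labelX labelY enumA enumB E Φ₁ won
      size-by-cells : ∑[ e ∈ E ] compatible e ≡ ∑[ α ∈ la ] ∑[ β ∈ lb ] (Φ₁ α β ℕ.* cellSize α β)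
      size-by-cells = begin
        ∑[ e ∈ E ] compatible e
          ≡⟨ ∑-cong E (λ e → sym (ℕ.*-identityʳ (compatible e))) ⟩
        ∑[ e ∈ E ] (compatible e ℕ.* 1)
          ≡⟨ ∑-by-cells _≟A_ _≟B_ labelX labelY enumA enumB E Φ₁ (λ _ → 1) ⟩
        ∑[ α ∈ la ] ∑[ β ∈ lb ] (Φ₁ α β ℕ.* ∑[ e ∈ E ] (cell e α β ℕ.* 1))
          ≡⟨ ∑-cong la (λ α → ∑-cong lb (λ β → cong (Φ₁ α β ℕ.*_) (∑-cong E (λ e → ℕ.*-identityʳ (cell e α β))))) ⟩
        ∑[ α ∈ la ] ∑[ β ∈ lb ] (Φ₁ α β ℕ.* cellSize α β) ∎
        where open ≡-Reasoning

    row-size : ∀ α → ∑[ β ∈ lb ] cellSize α β ≡ ∣ fibreX α ∣ ℕ.* dX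
    row-size α = begin
      ∑[ β ∈ lb ] ∑[ e ∈ E ] cell e α β     ≡⟨ ∑-swap lb E (λ β e → cell e α β) ⟩
      ∑[ e ∈ E ] ∑[ β ∈ lb ] cell e α β     ≡⟨ ∑-cong E (λ e → ∑-row _≟A_ _≟B_ labelX labelY enumA enumB e α) ⟩
      ∑[ e ∈ E ] 𝟙? (labelX e ≟A α)         ≡⟨ ∑-cong E (λ e → cong 𝟙 (mem-tabulate (λ x → does (φ x ≟A α)) (edgeX e))) ⟨
      ∑[ e ∈ E ] 𝟙? (edgeX e ∈? fibreX α)   ≡⟨ edges-into edgeX dX regularX (fibreX α) ⟩
      ∣ fibreX α ∣ ℕ.* dX                   ∎
      where open ≡-Reasoning

    column-size : ∀ β → ∑[ α ∈ la ] cellSize α β ≡ ∣ fibreY β ∣ ℕ.* dY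
    column-size β = begin
      ∑[ α ∈ la ] ∑[ e ∈ E ] cell e α β     ≡⟨ ∑-swap la E (λ α e → cell e α β) ⟩
      ∑[ e ∈ E ] ∑[ α ∈ la ] cell e α β     ≡⟨ ∑-cong E (λ e → ∑-column _≟A_ _≟B_ labelX labelY enumA enumB e β) ⟩
      ∑[ e ∈ E ] 𝟙? (labelY e ≟B β)         ≡⟨ ∑-cong E (λ e → cong 𝟙 (mem-tabulate (λ y → does (γ y ≟B β)) (edgeY e))) ⟨
      ∑[ e ∈ E ] 𝟙? (edgeY e ∈? fibreY β)   ≡⟨ edges-into edgeY dY regularY (fibreY β) ⟩
      ∣ fibreY β ∣ ℕ.* dY                   ∎
      where open ≡-Reasoning

    smallX-total : ℕ
    smallX-total = ∑[ α ∈ la ] (smallX α ℕ.* (∣ fibreX α ∣ ℕ.* dX))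

    smallY-total : ℕ
    smallY-total = ∑[ β ∈ lb ] (smallY β ℕ.* (∣ fibreY β ∣ ℕ.* dY))

    smallCells-by-sides : smallCells ≡ smallX-total ℕ.+ smallY-total
    smallCells-by-sides = begin
      ∑[ α ∈ la ] ∑[ β ∈ lb ] (smallX α ℕ.* cellSize α β ℕ.+ smallY β ℕ.* cellSize α β)
        ≡⟨ ∑-cong la (λ α → ∑-+ lb (λ β → smallX α ℕ.* cellSize α β) (λ β → smallY β ℕ.* cellSize α β)) ⟩
      ∑[ α ∈ la ] (∑[ β ∈ lb ] (smallX α ℕ.* cellSize α β) ℕ.+ ∑[ β ∈ lb ] (smallY β ℕ.* cellSize α β))
        ≡⟨ ∑-+ la _ _ ⟩
      ∑[ α ∈ la ] ∑[ β ∈ lb ] (smallX α ℕ.* cellSize α β) ℕ.+ ∑[ α ∈ la ] ∑[ β ∈ lb ] (smallY β ℕ.* cellSize α β)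
        ≡⟨ cong₂ ℕ._+_ (∑-cong la (λ α → ∑-*ˡ lb (smallX α) (cellSize α)))
                       (trans (∑-swap la lb _) (∑-cong lb (λ β → ∑-*ˡ la (smallY β) (λ α → cellSize α β)))) ⟩
      ∑[ α ∈ la ] (smallX α ℕ.* ∑[ β ∈ lb ] cellSize α β) ℕ.+ ∑[ β ∈ lb ] (smallY β ℕ.* ∑[ α ∈ la ] cellSize α β)
        ≡⟨ cong₂ ℕ._+_ (∑-cong la (λ α → cong (smallX α ℕ.*_) (row-size α)))
                       (∑-cong lb (λ β → cong (smallY β ℕ.*_) (column-size β))) ⟩
      ∑[ α ∈ la ] (smallX α ℕ.* (∣ fibreX α ∣ ℕ.* dX)) ℕ.+ ∑[ β ∈ lb ] (smallY β ℕ.* (∣ fibreY β ∣ ℕ.* dY)) ∎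
      where open ≡-Reasoning

    -- Each label class with a small side carries at most δ·m edges.
    smallCells-bound : ℕ→ℚ smallCells ≤ (ℕ→ℚ (length la ℕ.+ length lb) * δ) * ℕ→ℚ m
    smallCells-bound = begin
      ℕ→ℚ smallCells
        ≡⟨ trans (cong ℕ→ℚ smallCells-by-sides) (ℕ→ℚ-+ smallX-total smallY-total) ⟩
      ℕ→ℚ smallX-total + ℕ→ℚ smallY-total
        ≤⟨ +-mono-≤ (∑-bound la (δ * ℕ→ℚ m) _ (λ α → small-side nX dX m≡nX*dX ∣ fibreX α ∣ (largeX? α)))
                    (∑-bound lb (δ * ℕ→ℚ m) _ (λ β → small-side nY dY m≡nY*dY ∣ fibreY β ∣ (largeY? β))) ⟩
      ℕ→ℚ (length la) * (δ * ℕ→ℚ m) + ℕ→ℚ (length lb) * (δ * ℕ→ℚ m)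
        ≡⟨ distrib (ℕ→ℚ (length la)) (ℕ→ℚ (length lb)) δ (ℕ→ℚ m) ⟩
      ((ℕ→ℚ (length la) + ℕ→ℚ (length lb)) * δ) * ℕ→ℚ m
        ≡⟨ cong (λ t → (t * δ) * ℕ→ℚ m) (ℕ→ℚ-+ (length la) (length lb)) ⟨
      (ℕ→ℚ (length la ℕ.+ length lb) * δ) * ℕ→ℚ m ∎
      where
      open ≤-Reasoning
      distrib : ∀ a b d M → a * (d * M) + b * (d * M) ≡ ((a + b) * d) * M
      distrib = solve 4 (λ a b d M → a :* (d :* M) :+ b :* (d :* M) := ((a :+ b) :* d) :* M) refl

  StrategyX StrategyY : ℕ → Set
  StrategyX j = Vec (Fin nX) j → Vec (Fin aX) j
  StrategyY j = Vec (Fin nY) j → Vec (Fin aY) j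

  wins : ∀ j → StrategyX j → StrategyY j → ℕ
  wins j F H = ∑[ es ∈ tuples j E ] 𝟙 (allOK es (F (Vec.map edgeX es)) (H (Vec.map edgeY es)))

  accCount-repeat : ∀ j F H → accCount (repeatGame j G) F H ≡ wins j F H
  accCount-repeat j F H = begin
    accCount (repeatGame j G) F H
      ≡⟨ length-filter _ (Data.List.map bundle (tuples j E)) ⟩
    ∑[ b ∈ Data.List.map bundle (tuples j E) ] 𝟙? (T? (accepts b))
      ≡⟨ ∑-map bundle (tuples j E) (λ b → 𝟙? (T? (accepts b))) ⟩
    ∑[ es ∈ tuples j E ] 𝟙? (T? (accepts (bundle es)))
      ≡⟨ ∑-cong (tuples j E) (λ es → 𝟙?-T? (accepts (bundle es))) ⟩
    wins j F H ∎
    where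
    open ≡-Reasoning
    Question : Set
    Question = Vec (Fin nX) j × Vec (Fin nY) j × (Vec (Fin aX) j → Vec (Fin aY) j → Bool)
    bundle : Vec Edge j → Question
    bundle es = Vec.map edgeX es , Vec.map edgeY es , allOK es
    accepts : Question → Bool
    accepts (xs , ys , ok) = ok (F xs) (H ys)

  numEdges-repeat : ∀ j → numEdges (repeatGame j G) ≡ m ℕ.^ j
  numEdges-repeat j = trans (length-map _ (tuples j E)) (length-tuples j E)

  wins≤all : ∀ j F H → wins j F H ≤ℕ m ℕ.^ j
  wins≤all j F H = ℕ.≤-trans (∑-mono (tuples j E) (λ es → 𝟙≤1 _))
                             (ℕ.≤-reflexive (trans (sym (length≡∑1 (tuples j E))) (length-tuples j E)))

  wins-zero : ∀ F H → wins 0 F H ≡ 1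
  wins-zero F H = cong (λ b → 𝟙 b ℕ.+ 0) (allOK-[] (F []) (H []))
    where
    allOK-[] : ∀ (as : Vec (Fin aX) 0) (bs : Vec (Fin aY) 0) → allOK {Fin nX} {Fin nY} [] as bs ≡ true
    allOK-[] [] [] = refl

  wins-suc : ∀ j F H → wins (suc j) F H
             ≡ ∑[ es ∈ tuples j E ] ∑[ e ∈ E ]
                 𝟙 (allOK (e ∷ es) (F (edgeX e ∷ Vec.map edgeX es)) (H (edgeY e ∷ Vec.map edgeY es)))
  wins-suc j F H = trans (∑-tuples-suc j E _) (∑-swap E (tuples j E) _)

  continueX : ∀ {j} → StrategyX (suc j) → Edge → StrategyX j
  continueX F e xs = Vec.tail (F (edgeX e ∷ xs))

  continueY : ∀ {j} → StrategyY (suc j) → Edge → StrategyY j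
  continueY H e ys = Vec.tail (H (edgeY e ∷ ys))

  allOK-∷ : ∀ {j} e (es : Vec Edge j) (as : Vec (Fin aX) (suc j)) (bs : Vec (Fin aY) (suc j)) →
            𝟙 (allOK (e ∷ es) as bs) ≡ 𝟙 (allOK es (Vec.tail as) (Vec.tail bs)) ℕ.* 𝟙 (constraint e (Vec.head as) (Vec.head bs))
  allOK-∷ (_ , _ , ψ) es (a ∷ as) (b ∷ bs) = trans (𝟙-∧ (ψ a b) (allOK es as bs)) (ℕ.*-comm (𝟙 (ψ a b)) _)

  -- One round of the repetition: with the last j edges fixed to es, the first coordinate is
  -- played with the answers' remaining j coordinates as labels of the questions.
  module FirstRound {j} (F : StrategyX (suc j)) (H : StrategyY (suc j)) (es : Vec Edge j) where

    open Cells (Vec.≡-dec Fin._≟_) (Vec.≡-dec Fin._≟_)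
               (tuples-enumerates j Fin._≟_ (allFin-enumerates aX)) (tuples-enumerates j Fin._≟_ (allFin-enumerates aY))
               (λ x → Vec.head (F (x ∷ Vec.map edgeX es))) (λ y → Vec.head (H (y ∷ Vec.map edgeY es)))
               (λ x → Vec.tail (F (x ∷ Vec.map edgeX es))) (λ y → Vec.tail (H (y ∷ Vec.map edgeY es)))
               (allOK es)
      public

    round-wins : ℕ
    round-wins = ∑[ e ∈ E ] 𝟙 (allOK (e ∷ es) (F (edgeX e ∷ Vec.map edgeX es)) (H (edgeY e ∷ Vec.map edgeY es)))

    round-bound : ℕ→ℚ round-wins ≤ c * ℕ→ℚ (∑[ e ∈ E ] compatible e) + ℕ→ℚ smallCells
    round-bound = subst (λ w → ℕ→ℚ w ≤ c * ℕ→ℚ (∑[ e ∈ E ] compatible e) + ℕ→ℚ smallCells)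
                        (∑-cong E (λ e → sym (allOK-∷ e es (F (edgeX e ∷ Vec.map edgeX es)) (H (edgeY e ∷ Vec.map edgeY es)))))
                        compatible-bound

    -- There are |ΣX|^j + |ΣY|^j labels in all.
    round-small : ℕ→ℚ smallCells ≤ (ℕ→ℚ (aX ℕ.^ j ℕ.+ aY ℕ.^ j) * δ) * ℕ→ℚ m
    round-small = subst (λ L → ℕ→ℚ smallCells ≤ (ℕ→ℚ L * δ) * ℕ→ℚ m)
                        (cong₂ ℕ._+_ (labels aX) (labels aY)) smallCells-bound
      where
      labels : ∀ a → length (tuples j (allFin a)) ≡ a ℕ.^ j
      labels a = trans (length-tuples j (allFin a)) (cong (ℕ._^ j) (length-tabulate {n = a} id))

  bound : ℕ → ℚ
  bound j = c ^ℚ j + ℕ→ℚ j * ε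

  peel-round : ∀ j → ℕ→ℚ (aX ℕ.^ j ℕ.+ aY ℕ.^ j) * δ ≤ ε → ∀ F H →
               ℕ→ℚ (wins (suc j) F H)
               ≤ c * ℕ→ℚ (∑[ e ∈ E ] wins j (continueX F e) (continueY H e)) + ℕ→ℚ (m ℕ.^ j) * (ε * ℕ→ℚ m)
  peel-round j fewLabels F H = begin
    ℕ→ℚ (wins (suc j) F H)
      ≡⟨ cong ℕ→ℚ (wins-suc j F H) ⟩
    ℕ→ℚ (∑[ es ∈ tuples j E ] round-wins es)
      ≤⟨ ∑-affine-bound (tuples j E) c round-wins continuations smallCells (λ es → FirstRound.round-bound F H es) ⟩
    c * ℕ→ℚ (∑ (tuples j E) continuations) + ℕ→ℚ (∑ (tuples j E) smallCells)
      ≡⟨ cong (λ w → c * ℕ→ℚ w + ℕ→ℚ (∑ (tuples j E) smallCells)) (∑-swap (tuples j E) E _) ⟩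
    c * ℕ→ℚ (∑[ e ∈ E ] wins j (continueX F e) (continueY H e)) + ℕ→ℚ (∑ (tuples j E) smallCells)
      ≤⟨ +-monoʳ-≤ (c * ℕ→ℚ (∑[ e ∈ E ] wins j (continueX F e) (continueY H e))) (∑-bound (tuples j E) (ε * ℕ→ℚ m) smallCells small≤εm) ⟩
    c * ℕ→ℚ (∑[ e ∈ E ] wins j (continueX F e) (continueY H e)) + ℕ→ℚ (length (tuples j E)) * (ε * ℕ→ℚ m)
      ≡⟨ cong (λ n → c * ℕ→ℚ (∑[ e ∈ E ] wins j (continueX F e) (continueY H e)) + ℕ→ℚ n * (ε * ℕ→ℚ m))
              (length-tuples j E) ⟩
    c * ℕ→ℚ (∑[ e ∈ E ] wins j (continueX F e) (continueY H e)) + ℕ→ℚ (m ℕ.^ j) * (ε * ℕ→ℚ m) ∎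
    where
    open ≤-Reasoning
    round-wins continuations smallCells : Vec Edge j → ℕ
    round-wins    es = FirstRound.round-wins F H es
    continuations es = ∑[ e ∈ E ] FirstRound.compatible F H es e
    smallCells    es = FirstRound.smallCells F H es
    small≤εm : ∀ es → ℕ→ℚ (smallCells es) ≤ ε * ℕ→ℚ m
    small≤εm es = ≤-trans (FirstRound.round-small F H es) (*-monoʳ-≤-0≤ (ℕ→ℚ m) (ℕ→ℚ-nonNeg m) fewLabels)

  wins-bound : 0ℚ ≤ ε → c ≤ 1ℚ → ∀ j → (∀ i → i ℕ.< j → ℕ→ℚ (aX ℕ.^ i ℕ.+ aY ℕ.^ i) * δ ≤ ε) →
               ∀ F H → ℕ→ℚ (wins j F H) ≤ bound j * ℕ→ℚ (m ℕ.^ j)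
  wins-bound 0≤ε c≤1 zero    _         F H = ≤-reflexive (trans (cong ℕ→ℚ (wins-zero F H))
    (solve 1 (λ ε → con 1ℚ := (con 1ℚ :+ con 0ℚ :* ε) :* con 1ℚ) refl ε))
  wins-bound 0≤ε c≤1 (suc j) fewLabels F H = begin
    ℕ→ℚ (wins (suc j) F H)
      ≤⟨ peel-round j (fewLabels j ℕ.≤-refl) F H ⟩
    c * ℕ→ℚ (∑[ e ∈ E ] wins j (continueX F e) (continueY H e)) + P * (ε * M)
      ≤⟨ +-monoˡ-≤ (P * (ε * M)) (*-monoˡ-≤-0≤ c 0≤c
           (∑-bound E (bound j * P) _ (λ e → wins-bound 0≤ε c≤1 j (λ i i<j → fewLabels i (ℕ.m<n⇒m<1+n i<j))
                                                     (continueX F e) (continueY H e)))) ⟩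
    c * (M * (bound j * P)) + P * (ε * M)
      ≡⟨ regroup c M (bound j) P ε ⟩
    (c * bound j + ε) * (M * P)
      ≤⟨ *-monoʳ-≤-0≤ (M * P) (0≤* (ℕ→ℚ-nonNeg m) (ℕ→ℚ-nonNeg (m ℕ.^ j))) (error-step j 0≤ε c≤1) ⟩
    bound (suc j) * (M * P)
      ≡⟨ cong (bound (suc j) *_) (ℕ→ℚ-* m (m ℕ.^ j)) ⟨
    bound (suc j) * ℕ→ℚ (m ℕ.^ suc j) ∎
    where
    open ≤-Reasoning
    M P : ℚ
    M = ℕ→ℚ m
    P = ℕ→ℚ (m ℕ.^ j)
    regroup : ∀ c M b P ε → c * (M * (b * P)) + P * (ε * M) ≡ (c * b + ε) * (M * P)
    regroup = solve 5 (λ c M b P ε → c :* (M :* (b :* P)) :+ P :* (ε :* M) := (c :* b :+ ε) :* (M :* P)) refl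

  repeat-hasEdge : 0 ℕ.< m → ∀ k → 0 ℕ.< numEdges (repeatGame k G)
  repeat-hasEdge hasEdge k = subst (0 ℕ.<_) (sym (numEdges-repeat k)) (ℕ.m^n>0 m {{ℕ.>-nonZero hasEdge}} k)

  winning-fraction : ∀ k q → (∀ F H → ℕ→ℚ (wins k F H) ≤ q * ℕ→ℚ (m ℕ.^ k)) → ValLe (repeatGame k G) q
  winning-fraction k q bounded F H = subst₂ (λ w n → ℕ→ℚ w ≤ q * ℕ→ℚ n)
    (sym (accCount-repeat k F H)) (sym (numEdges-repeat k)) (bounded F H)

  -- The value of G^k is at most c^k + k·ε: by the main estimate when c ≤ 1, and trivially
  -- when c ≥ 1, since then the bound is at least 1.
  repeat-value : 0 ℕ.< m → 0ℚ ≤ ε → ∀ k → (∀ i → i ℕ.< k → ℕ→ℚ (aX ℕ.^ i ℕ.+ aY ℕ.^ i) * δ ≤ ε) →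
                 ∀ {vk} → IsVal (repeatGame k G) vk → vk ≤ bound k
  repeat-value hasEdge 0≤ε k fewLabels {vk} isValᵏ = [ below-one , above-one ]′ (≤-total c 1ℚ)
    where
    below-one : c ≤ 1ℚ → vk ≤ bound k
    below-one c≤1 = value-≤ (repeatGame k G) (repeat-hasEdge hasEdge k) isValᵏ (bound k)
                      (winning-fraction k (bound k) (wins-bound 0≤ε c≤1 k fewLabels))
    all-wins : ∀ F H → ℕ→ℚ (wins k F H) ≤ 1ℚ * ℕ→ℚ (m ℕ.^ k)
    all-wins F H = ≤-trans (ℕ→ℚ-mono-≤ (wins≤all k F H)) (≤-reflexive (sym (*-identityˡ (ℕ→ℚ (m ℕ.^ k)))))
    above-one : 1ℚ ≤ c → vk ≤ bound k
    above-one 1≤c = begin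
      vk        ≤⟨ value-≤ (repeatGame k G) (repeat-hasEdge hasEdge k) isValᵏ 1ℚ (winning-fraction k 1ℚ all-wins) ⟩
      1ℚ        ≤⟨ ^ℚ-≥1 1≤c k ⟩
      c ^ℚ k    ≡⟨ +-identityʳ (c ^ℚ k) ⟨
      c ^ℚ k + 0ℚ ≤⟨ +-monoʳ-≤ (c ^ℚ k) (0≤* (ℕ→ℚ-nonNeg k) 0≤ε) ⟩
      bound k   ∎
      where open ≤-Reasoning

open import Data.Nat using (ℕ; _∸_; _<_)
open import Data.Fin using (Fin)
open import Data.Rational using (ℚ; _≤_; _+_; _*_; 0ℚ)
open import Data.Rational using () renaming (_<_ to _<ℚ_)
import Data.Nat as ℕ
import Data.Nat.Properties as ℕ
open import Data.Fin.Properties using (nonZeroIndex)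
open import Data.List using (List; _∷_; length)
open import Data.Product using (_×_; _,_; proj₁; proj₂)
open import Data.Rational.Properties using (≤-trans; ≤-reflexive; +-mono-≤; +-identityʳ; <⇒≤)
open import Data.Rational.Solver using (module +-*-Solver)
open +-*-Solver using (solve; _:*_; _:=_)
open import Relation.Binary.PropositionalEquality using (refl; sym; trans; cong)
open NatEmbedding
open Values

nonempty-alphabets : ∀ {X Y Ψ : Set} {aX aY : ℕ} (E : List (X × Y × Ψ)) → 0 < length E →
                     (X → Fin aX) → (Y → Fin aY) → ℕ.NonZero aX × ℕ.NonZero aY
nonempty-alphabets ((x , y , _) ∷ _) _ f g = nonZeroIndex (f x) , nonZeroIndex (g y)

<⇒≤∸1 : ∀ {i k} → i < k → i ℕ.≤ k ∸ 1
<⇒≤∸1 (ℕ.s≤s i≤k) = i≤k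

-- The hypothesis 2δ·|ΣX × ΣY|^(k-1) ≤ ε pays for the labels of every round peeled off G^k.
label-budget : ∀ aX aY .{{_ : ℕ.NonZero aX}} .{{_ : ℕ.NonZero aY}} k {δ ε : ℚ} → 0ℚ ≤ δ →
               ℕ→ℚ 2 * δ * (ℕ→ℚ (aX ℕ.* aY) ^ℚ (k ∸ 1)) ≤ ε →
               ∀ i → i < k → ℕ→ℚ (aX ℕ.^ i ℕ.+ aY ℕ.^ i) * δ ≤ ε
label-budget aX aY k {δ} {ε} 0≤δ budget i i<k = begin
  ℕ→ℚ (aX ℕ.^ i ℕ.+ aY ℕ.^ i) * δ          ≤⟨ *-monoʳ-≤-0≤ δ 0≤δ (ℕ→ℚ-mono-≤ label-count) ⟩
  ℕ→ℚ (2 ℕ.* P) * δ                         ≡⟨ cong (_* δ) (trans (ℕ→ℚ-* 2 P) (cong (ℕ→ℚ 2 *_) (ℕ→ℚ-^ (aX ℕ.* aY) (k ∸ 1)))) ⟩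
  (ℕ→ℚ 2 * ℕ→ℚ (aX ℕ.* aY) ^ℚ (k ∸ 1)) * δ  ≡⟨ swap (ℕ→ℚ 2) (ℕ→ℚ (aX ℕ.* aY) ^ℚ (k ∸ 1)) δ ⟩
  ℕ→ℚ 2 * δ * (ℕ→ℚ (aX ℕ.* aY) ^ℚ (k ∸ 1))  ≤⟨ budget ⟩
  ε                                         ∎
  where
  open Data.Rational.Properties.≤-Reasoning
  P : ℕ
  P = (aX ℕ.* aY) ℕ.^ (k ∸ 1)
  swap : ∀ t q d → (t * q) * d ≡ t * d * q
  swap = solve 3 (λ t q d → (t :* q) :* d := t :* d :* q) refl
  power≤P : ∀ a → a ℕ.≤ aX ℕ.* aY → a ℕ.^ i ℕ.≤ P
  power≤P a a≤aXaY = ℕ.≤-trans (ℕ.^-monoˡ-≤ i a≤aXaY)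
                               (ℕ.^-monoʳ-≤ (aX ℕ.* aY) {{ℕ.m*n≢0 aX aY}} (<⇒≤∸1 i<k))
  label-count : aX ℕ.^ i ℕ.+ aY ℕ.^ i ℕ.≤ 2 ℕ.* P
  label-count = ℕ.≤-trans (ℕ.+-mono-≤ (power≤P aX (ℕ.m≤m*n aX aY)) (power≤P aY (ℕ.m≤n*m aY aX)))
                          (ℕ.≤-reflexive (cong (P ℕ.+_) (sym (ℕ.+-identityʳ P))))

mainTheorem4 : ∀ (nX nY aX aY : ℕ) (G : Game (Fin nX) (Fin nY) (Fin aX) (Fin aY))
    → 0 < numEdges G → BiRegular G
    → (k : ℕ) → 0 < k → (ε δ : ℚ) → 0ℚ <ℚ ε → 0ℚ <ℚ δ
    → ℕ→ℚ 2 * δ * (ℕ→ℚ (aX Data.Nat.* aY) ^ℚ (k ∸ 1)) ≤ ε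
    → Robust G δ ε
    → (v vk : ℚ) → IsVal G v → IsVal (repeatGame k G) vk
    → vk ≤ ((v + ε) ^ℚ k) + ℕ→ℚ k * ε
mainTheorem4 nX nY aX aY G hasEdge ((dX , regularX) , (dY , regularY)) k _ ε δ 0<ε 0<δ budget robust
             v vk isVal@(_ , f , g , _) isValᵏ =
  repeat-value hasEdge (<⇒≤ 0<ε) k (label-budget aX aY {{proj₁ alphabets}} {{proj₂ alphabets}} k (<⇒≤ 0<δ) budget) isValᵏ
  where
  alphabets : ℕ.NonZero aX × ℕ.NonZero aY
  alphabets = nonempty-alphabets (edges G) hasEdge f g
  0≤v+ε : 0ℚ ≤ v + ε
  0≤v+ε = ≤-trans (≤-reflexive (sym (+-identityʳ 0ℚ))) (+-mono-≤ (value-nonNeg G hasEdge {v} isVal) (<⇒≤ 0<ε))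
  open RobustGame G v ε δ isVal robust dX dY regularX regularY 0≤v+ε (<⇒≤ 0<δ)
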